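{- Let $n\ge 1$ and $k>n$ be integers. In Black-Peg Mastermind with $n$ positions and $k$ colors without color repetition, there is a deterministic adaptive strategy for the codebreaker, using only queries with pairwise distinct entries, that determines every secret code after at most $(n-2)\lceil\log_2 n\rceil+k+1$ queries.
   Context: The codemaker fixes a secret code $y=(y_1,\dots,y_n)\in[k]^n$ with pairwise distinct entries, where $[k]=\{1,\dots,k\}$. The codebreaker adaptively submits queries $x\in[k]^n$ with pairwise distinct entries (each query may depend on the answers to all previous queries), and after each query receives only the answer $\mathrm{black}(x,y)=|\{i\in[n]: x_i=y_i\}|$. A strategy determines $y$ after $N$ queries if $y$ is uniquely determined by the first $N$ queries and their answers. -}

module Defs where

open import Data.Nat using (ℕ; zero; suc)
open import Data.Fin using (Fin; _≟_)
open import Data.List using (List; []; _∷_; _++_; length; filter; allFin)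
open import Data.List.Relation.Unary.All using (All)
open import Data.Product using (Σ; _×_; _,_; proj₁)
open import Function.Definitions using (Injective)
open import Relation.Binary.PropositionalEquality using (_≡_)

Code : ℕ → ℕ → Set
Code n k = Σ (Fin n → Fin k) (Injective _≡_ _≡_)

black : ∀ {n k} → (Fin n → Fin k) → (Fin n → Fin k) → ℕ
black {n} x y = length (filter (λ i → x i ≟ y i) (allFin n))

-- A deterministic adaptive strategy: the next query is a function of the
-- list of answers received so far (oldest first); since the strategy is
-- deterministic, earlier queries are themselves determined by earlier answers.
Strategy : ℕ → ℕ → Set
Strategy n k = List ℕ → Code n k

transcript : ∀ {n k} → Strategy n k → Code n k → ℕ → List (Code n k × ℕ)
transcript s y zero = []
transcript s y (suc m) =
  let t = transcript s y m
      q = s (answersOf t)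
  in t ++ ((q , black (proj₁ q) (proj₁ y)) ∷ [])
  where
  answersOf : ∀ {n k} → List (Code n k × ℕ) → List ℕ
  answersOf [] = []
  answersOf ((_ , a) ∷ r) = a ∷ answersOf r

Consistent : ∀ {n k} → Code n k → List (Code n k × ℕ) → Set
Consistent z t = All (λ qa → black (proj₁ (proj₁ qa)) (proj₁ z) ≡ Data.Product.proj₂ qa) t
  where import Data.Product

DeterminesAfter : ∀ {n k} → Strategy n k → Code n k → ℕ → Set
DeterminesAfter {n} {k} s y m =
  (z : Code n k) → Consistent z (transcript s y m) → ∀ i → proj₁ z i ≡ proj₁ y i

-- First ask the k cyclic shifts x(i) = i + e mod k (0 ≤ e < k).  Each position agrees with exactly
-- one of them, so the scores sum to n < k and some shift z scores 0.  Then treat the offsets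
-- j = z + k − 1, …, z + 1 in turn; the survey tells how many still unknown positions satisfy
-- y(i) = i + j.  Each of them is located by binary search over the unknown positions, with the
-- query that uses offset j below a threshold and offset j + 1 from it on: it is injective, and
-- offset j + 1 (already treated, or z) has no unknown position left to hit.  With u unknown
-- positions the search costs ⌈log₂ u⌉, and u drops by one per position found, so the searches
-- cost at most ⌈log₂ 1⌉ + … + ⌈log₂ n⌉ ≤ (n − 2)⌈log₂ n⌉ + 1 on top of the k survey queries.

module Submission where

open import Defs
open import Data.Bool using (Bool; true; false; not; _∧_; if_then_else_; T)
open import Data.Bool.Properties using (T-∧; ∧-identityʳ)
open import Data.Empty using (⊥-elim)
open import Data.Fin using (Fin; zero; suc; toℕ)
import Data.Fin as Fin
import Data.Fin.Properties as FinP
open import Data.List using (List; []; _∷_; _++_; length; filter; tabulate; allFin)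
open import Data.List.Membership.Propositional using (_∈_)
open import Data.List.Membership.Propositional.Properties using (∈-filter⁺; ∈-allFin)
open import Data.List.Relation.Unary.All as All using (All; []; _∷_)
open import Data.List.Relation.Unary.AllPairs using (AllPairs; []; _∷_)
import Data.List.Relation.Unary.AllPairs.Properties as AllPairsP
open import Data.List.Relation.Unary.Any using (here; there)
open import Data.Nat using (ℕ; zero; suc; _+_; _*_; _∸_; _≤_; _<_; _<?_; _<ᵇ_; z≤n; s≤s; NonZero; ⌊_/2⌋; ⌈_/2⌉)
import Data.Nat as ℕ
open import Data.Nat.DivMod using (_%_; _mod_; %-distribˡ-+; m%n%n≡m%n; m%n≤n; m%n<n; [m+n]%n≡m%n; m<n⇒m%n≡m)
open import Data.Nat.Logarithm using (⌈log₂_⌉; ⌈log₂⌉-mono-≤; ⌈log₂⌈n/2⌉⌉≡⌈log₂n⌉∸1)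
open import Data.Nat.Properties
open import Data.Product using (Σ; ∃; _×_; _,_; proj₁; proj₂)
open import Data.Vec.Functional using (updateAt)
open import Data.Vec.Functional.Properties using (updateAt-updates; updateAt-minimal)
open import Function using (_∘_; id; const)
open import Function.Bundles using (Equivalence)
open import Function.Definitions using (Injective)
open import Level using (Level)
open import Relation.Binary.PropositionalEquality
open import Relation.Nullary using (does; ¬_; yes; no)
open import Relation.Nullary.Decidable using (T?)
open import Relation.Nullary.Reflects using (ofʸ; ofⁿ)
open import Relation.Unary using (Pred; Decidable)

⌈log₂⌉-halve : ∀ d → suc ⌈log₂ ⌈ suc (suc d) /2⌉ ⌉ ≡ ⌈log₂ suc (suc d) ⌉
⌈log₂⌉-halve d = trans (cong suc (⌈log₂⌈n/2⌉⌉≡⌈log₂n⌉∸1 (suc (suc d))))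
                       (m+[n∸m]≡n (⌈log₂⌉-mono-≤ {2} {suc (suc d)} (s≤s (s≤s z≤n))))

module Adaptive {n k : ℕ} (default : Code n k) where

  data Tree (A : Set) : Set where
    ret : A → Tree A
    ask : Code n k → (ℕ → Tree A) → Tree A

  infixl 1 _>>=_
  infixr 4 _<$>_

  _>>=_ : ∀ {A B} → Tree A → (A → Tree B) → Tree B
  ret a   >>= g = g a
  ask q f >>= g = ask q (λ a → f a >>= g)

  _<$>_ : ∀ {A B} → (A → B) → Tree A → Tree B
  f <$> t = t >>= ret ∘ f

  answer : Code n k → Code n k → ℕ
  answer q y = black (proj₁ q) (proj₁ y)

  run : ∀ {A} → Code n k → Tree A → A
  run y (ret a)   = a
  run y (ask q f) = run y (f (answer q y))

  cost : ∀ {A} → Code n k → Tree A → ℕ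
  cost y (ret a)   = 0
  cost y (ask q f) = suc (cost y (f (answer q y)))

  run->>= : ∀ {A B} y (t : Tree A) (g : A → Tree B) → run y (t >>= g) ≡ run y (g (run y t))
  run->>= y (ret a)   g = refl
  run->>= y (ask q f) g = run->>= y (f (answer q y)) g

  cost->>= : ∀ {A B} y (t : Tree A) (g : A → Tree B) →
             cost y (t >>= g) ≡ cost y t + cost y (g (run y t))
  cost->>= y (ret a)   g = refl
  cost->>= y (ask q f) g = cong suc (cost->>= y (f (answer q y)) g)

  run-<$> : ∀ {A B} y (f : A → B) (t : Tree A) → run y (f <$> t) ≡ f (run y t)
  run-<$> y f t = run->>= y t (ret ∘ f)

  cost-<$> : ∀ {A B} y (f : A → B) (t : Tree A) → cost y (f <$> t) ≡ cost y t
  cost-<$> y f t = trans (cost->>= y t (ret ∘ f)) (+-identityʳ (cost y t))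

  strategy : ∀ {A} → Tree A → Strategy n k
  strategy (ret _)   _        = default
  strategy (ask q _) []       = q
  strategy (ask q f) (a ∷ as) = strategy (f a) as

  play : ∀ {A} → Tree A → Code n k → ℕ → List (Code n k × ℕ)
  play t         y zero    = []
  play (ret v)   y (suc m) = (default , answer default y) ∷ play (ret v) y m
  play (ask q f) y (suc m) = (q , answer q y) ∷ play (f (answer q y)) y m

  play-ret-snoc : ∀ {A} (v : A) y m →
    play (ret v) y m ++ (default , answer default y) ∷ [] ≡ play (ret v) y (suc m)
  play-ret-snoc v y zero    = refl
  play-ret-snoc v y (suc m) = cong (_ ∷_) (play-ret-snoc v y m)

  -- transcript extracts the answer list with a function local to its where block, which cannot
  -- be named here: the recursion at m and m + 1 only rewrites underneath it.
  transcript-strategy : ∀ {A} (t : Tree A) y m → transcript (strategy t) y m ≡ play t y m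
  transcript-strategy t         y zero    = refl
  transcript-strategy (ret v)   y (suc m) rewrite transcript-strategy (ret v) y m = play-ret-snoc v y m
  transcript-strategy (ask q f) y (suc zero) = refl
  transcript-strategy (ask q f) y (suc (suc m))
    rewrite transcript-strategy (ask q f) y (suc m)
          | sym (transcript-strategy (f (answer q y)) y m)
          = cong (_ ∷_) (transcript-strategy (f (answer q y)) y (suc m))

  consistent⇒run≡ : ∀ {A} (t : Tree A) y z → Consistent z (play t y (cost y t)) → run z t ≡ run y t
  consistent⇒run≡ (ret v)   y z c        = refl
  consistent⇒run≡ (ask q f) y z (e ∷ c) rewrite e = consistent⇒run≡ (f (answer q y)) y z c

  strategy-determines : (t : Tree (Fin n → Fin k)) → (∀ y i → run y t i ≡ proj₁ y i) →
                        ∀ y → DeterminesAfter (strategy t) y (cost y t)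
  strategy-determines t correct y z c i = begin
    proj₁ z i    ≡⟨ sym (correct z i) ⟩
    run z t i    ≡⟨ cong (λ g → g i) (consistent⇒run≡ t y z c′) ⟩
    run y t i    ≡⟨ correct y i ⟩
    proj₁ y i    ∎
    where
    open ≡-Reasoning
    c′ = subst (Consistent z) (transcript-strategy t y (cost y t)) c

  module _ (test : ℕ → Tree Bool) where

    bisect : ℕ → ℕ → ℕ → Tree ℕ
    bisect zero    lo d          = ret lo
    bisect (suc fuel) lo zero       = ret lo
    bisect (suc fuel) lo (suc zero) = ret lo
    bisect (suc fuel) lo d@(suc (suc _)) = test (lo + ⌊ d /2⌋) >>= λ b →
      if b then bisect fuel lo ⌊ d /2⌋ else bisect fuel (lo + ⌊ d /2⌋) ⌈ d /2⌉

    Flips : Code n k → ℕ → ℕ → Set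
    Flips y lo hi = ¬ T (run y (test lo)) × T (run y (test hi))

    bisect-flips : ∀ y fuel lo d → 1 ≤ d → d ≤ fuel → Flips y lo (lo + d) →
                   let i = run y (bisect fuel lo d) in Flips y i (suc i)
    bisect-flips y zero lo (suc d) _ ()
    bisect-flips y (suc fuel) lo (suc zero) _ _ (below , above) = below , subst (λ m → T (run y (test m))) (+-comm lo 1) above
    bisect-flips y (suc fuel) lo d@(suc (suc d′)) _ d≤fuel (below , above)
      rewrite run->>= y (test (lo + ⌊ d /2⌋))
                (λ b → if b then bisect fuel lo ⌊ d /2⌋ else bisect fuel (lo + ⌊ d /2⌋) ⌈ d /2⌉)
      with run y (test (lo + ⌊ d /2⌋)) in mid
    ... | true  = bisect-flips y fuel lo ⌊ d /2⌋ (s≤s z≤n) (≤-pred (≤-trans (⌊n/2⌋<n (suc d′)) d≤fuel))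
                    (below , subst T (sym mid) _)
    ... | false = bisect-flips y fuel (lo + ⌊ d /2⌋) ⌈ d /2⌉ (s≤s z≤n) (≤-pred (≤-trans (⌈n/2⌉<n d′) d≤fuel))
                    (subst (¬_ ∘ T) (sym mid) (λ ()) , subst (λ m → T (run y (test m))) halves above)
      where
      halves : lo + d ≡ lo + ⌊ d /2⌋ + ⌈ d /2⌉
      halves = trans (cong (lo +_) (sym (⌊n/2⌋+⌈n/2⌉≡n d))) (sym (+-assoc lo ⌊ d /2⌋ ⌈ d /2⌉))

    bisect-cost : ∀ y → (∀ ℓ → cost y (test ℓ) ≡ 1) → ∀ fuel lo d → cost y (bisect fuel lo d) ≤ ⌈log₂ d ⌉
    bisect-cost y unit zero    lo d          = z≤n
    bisect-cost y unit (suc fuel) lo zero       = z≤n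
    bisect-cost y unit (suc fuel) lo (suc zero) = z≤n
    bisect-cost y unit (suc fuel) lo d@(suc (suc d′))
      rewrite cost->>= y (test (lo + ⌊ d /2⌋))
                (λ b → if b then bisect fuel lo ⌊ d /2⌋ else bisect fuel (lo + ⌊ d /2⌋) ⌈ d /2⌉)
            | unit (lo + ⌊ d /2⌋)
            | sym (⌈log₂⌉-halve d′)
      with run y (test (lo + ⌊ d /2⌋))
    ... | true  = s≤s (≤-trans (bisect-cost y unit fuel lo ⌊ d /2⌋) (⌈log₂⌉-mono-≤ (⌊n/2⌋≤⌈n/2⌉ d)))
    ... | false = s≤s (bisect-cost y unit fuel (lo + ⌊ d /2⌋) ⌈ d /2⌉)

count : ∀ {m} → (Fin m → Bool) → ℕ
count {zero}  f = 0
count {suc m} f = if f zero then suc (count (f ∘ suc)) else count (f ∘ suc)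

length-filter-tabulate : ∀ {m} {A : Set} {p : Level} {P : Pred A p} (P? : Decidable P) (f : Fin m → A) →
  length (filter P? (tabulate f)) ≡ count (λ i → does (P? (f i)))
length-filter-tabulate {zero}  P? f = refl
length-filter-tabulate {suc m} P? f with does (P? (f zero))
... | true  = cong suc (length-filter-tabulate P? (f ∘ suc))
... | false = length-filter-tabulate P? (f ∘ suc)

count-cong : ∀ {m} {f g : Fin m → Bool} → (∀ i → f i ≡ g i) → count f ≡ count g
count-cong {zero}          eq = refl
count-cong {suc m} {f} {g} eq rewrite eq zero = cong (λ c → if g zero then suc c else c) (count-cong (eq ∘ suc))

count-split : ∀ {m} (u f : Fin m → Bool) → count f ≡ count (λ i → u i ∧ f i) + count (λ i → not (u i) ∧ f i)
count-split {zero}  u f = refl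
count-split {suc m} u f with u zero | f zero | count-split (u ∘ suc) (f ∘ suc)
... | true  | true  | ih = cong suc ih
... | false | true  | ih = trans (cong suc ih) (sym (+-suc _ _))
... | true  | false | ih = ih
... | false | false | ih = ih

count-positive : ∀ {m} (f : Fin m → Bool) → 1 ≤ count f → ∃ λ i → T (f i)
count-positive {suc m} f pos with f zero in f0
... | true  = zero , subst T (sym f0) _
... | false with count-positive (f ∘ suc) pos
...   | i , fi = suc i , fi

1≤count : ∀ {m} (f : Fin m → Bool) i → T (f i) → 1 ≤ count f
1≤count {suc m} f zero    fi with f zero
... | true = s≤s z≤n
1≤count {suc m} f (suc i) fi with f zero
... | true  = m≤n⇒m≤1+n (1≤count (f ∘ suc) i fi)
... | false = 1≤count (f ∘ suc) i fi

count-zero : ∀ {m} (f : Fin m → Bool) → count f ≡ 0 → ∀ i → ¬ T (f i)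
count-zero f none i fi with () ← subst (1 ≤_) none (1≤count f i fi)

count≤ : ∀ {m} (f : Fin m → Bool) → count f ≤ m
count≤ {zero}  f = z≤n
count≤ {suc m} f with f zero
... | true  = s≤s (count≤ (f ∘ suc))
... | false = m≤n⇒m≤1+n (count≤ (f ∘ suc))

count-all : ∀ {m} (f : Fin m → Bool) → (∀ i → T (f i)) → count f ≡ m
count-all {zero}  f all = refl
count-all {suc m} f all with f zero | all zero
... | true | _ = cong suc (count-all (f ∘ suc) (all ∘ suc))

count-remove : ∀ {m} (f g : Fin m → Bool) x → T (f x) → ¬ T (g x) → (∀ i → i ≢ x → g i ≡ f i) →
               count f ≡ suc (count g)
count-remove {suc m} f g zero fx gx rest with f zero | g zero
... | true | true  = ⊥-elim (gx _)
... | true | false = cong suc (count-cong (λ i → sym (rest (suc i) λ ())))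
count-remove {suc m} f g (suc x) fx gx rest
  rewrite rest zero (λ ())
  with f zero | count-remove (f ∘ suc) (g ∘ suc) x fx gx (λ i i≢x → rest (suc i) (i≢x ∘ FinP.suc-injective))
... | true  | ih = cong suc ih
... | false | ih = ih

module Candidates {n : ℕ} where

  Ascending : List (Fin n) → Set
  Ascending = AllPairs (λ a b → toℕ a < toℕ b)

  bound : List (Fin n) → ℕ → ℕ
  bound []       ℓ       = n
  bound (c ∷ cs) zero    = toℕ c
  bound (c ∷ cs) (suc ℓ) = bound cs ℓ

  pick : Fin n → List (Fin n) → ℕ → Fin n
  pick d []       ℓ       = d
  pick d (c ∷ cs) zero    = c
  pick d (c ∷ cs) (suc ℓ) = pick d cs ℓ

  bound-length : ∀ cs → bound cs (length cs) ≡ n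
  bound-length []       = refl
  bound-length (c ∷ cs) = bound-length cs

  bound-zero≤ : ∀ {cs x} → Ascending cs → x ∈ cs → bound cs zero ≤ toℕ x
  bound-zero≤ (c<cs ∷ _) (here refl) = ≤-refl
  bound-zero≤ (c<cs ∷ _) (there x∈) = <⇒≤ (All.lookup c<cs x∈)

  <bound : ∀ {c} cs ℓ → All (λ b → toℕ c < toℕ b) cs → toℕ c < bound cs ℓ
  <bound {c} []       ℓ       _            = FinP.toℕ<n c
  <bound     (b ∷ cs) zero    (c<b ∷ _)    = c<b
  <bound     (b ∷ cs) (suc ℓ) (_ ∷ c<cs)   = <bound cs ℓ c<cs

  between-bounds⇒pick : ∀ d {cs x} i → Ascending cs → x ∈ cs →
                        bound cs i ≤ toℕ x → toℕ x < bound cs (suc i) → x ≡ pick d cs i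
  between-bounds⇒pick d zero    _          (here refl) _  _  = refl
  between-bounds⇒pick d zero    (_ ∷ asc)  (there x∈)  _  hi = ⊥-elim (<⇒≱ hi (bound-zero≤ asc x∈))
  between-bounds⇒pick d {c ∷ cs} (suc i) (c<cs ∷ _) (here refl) lo _ = ⊥-elim (<⇒≱ (<bound cs i c<cs) lo)
  between-bounds⇒pick d (suc i) (_ ∷ asc)  (there x∈)  lo hi = between-bounds⇒pick d i asc x∈ lo hi

  candidates : (Fin n → Bool) → List (Fin n)
  candidates u = filter (T? ∘ u) (allFin n)

  candidates-ascending : ∀ u → Ascending (candidates u)
  candidates-ascending u = AllPairsP.filter⁺ (T? ∘ u) (AllPairsP.tabulate⁺-< id)

  ∈-candidates : ∀ u {x} → T (u x) → x ∈ candidates u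
  ∈-candidates u ux = ∈-filter⁺ (T? ∘ u) (∈-allFin _) ux

  length-candidates : ∀ u → length (candidates u) ≡ count u
  length-candidates u = length-filter-tabulate (T? ∘ u) id

module Modular (k : ℕ) .{{_ : NonZero k}} where

  %-cong-+ʳ : ∀ {a b} c → a % k ≡ b % k → (a + c) % k ≡ (b + c) % k
  %-cong-+ʳ {a} {b} c a≡b = begin
    (a + c) % k            ≡⟨ %-distribˡ-+ a c k ⟩
    (a % k + c % k) % k    ≡⟨ cong (λ r → (r + c % k) % k) a≡b ⟩
    (b % k + c % k) % k    ≡⟨ %-distribˡ-+ b c k ⟨
    (b + c) % k            ∎
    where open ≡-Reasoning

  %-cong-+ˡ : ∀ {a b} c → a % k ≡ b % k → (c + a) % k ≡ (c + b) % k
  %-cong-+ˡ {a} {b} c a≡b = begin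
    (c + a) % k ≡⟨ cong (_% k) (+-comm c a) ⟩
    (a + c) % k ≡⟨ %-cong-+ʳ c a≡b ⟩
    (b + c) % k ≡⟨ cong (_% k) (+-comm b c) ⟩
    (c + b) % k ∎
    where open ≡-Reasoning

  -- Adding k ∸ c % k undoes adding c.
  %-cancel-+ʳ : ∀ {a b} c → (a + c) % k ≡ (b + c) % k → a % k ≡ b % k
  %-cancel-+ʳ {a} {b} c a+c≡b+c = begin
    a % k               ≡⟨ undo a ⟨
    (a + c + d) % k     ≡⟨ %-cong-+ʳ d a+c≡b+c ⟩
    (b + c + d) % k     ≡⟨ undo b ⟩
    b % k               ∎
    where
    open ≡-Reasoning
    d = k ∸ c % k
    undo : ∀ x → (x + c + d) % k ≡ x % k
    undo x = begin
      (x + c + d) % k        ≡⟨ %-cong-+ʳ d (%-cong-+ˡ x (sym (m%n%n≡m%n c k))) ⟩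
      (x + c % k + d) % k    ≡⟨ cong (_% k) (+-assoc x (c % k) d) ⟩
      (x + (c % k + d)) % k  ≡⟨ cong (λ r → (x + r) % k) (m+[n∸m]≡n (m%n≤n c k)) ⟩
      (x + k) % k            ≡⟨ [m+n]%n≡m%n x k ⟩
      x % k                  ∎

  %-injective : ∀ {a b} → a < k → b < k → a % k ≡ b % k → a ≡ b
  %-injective {a} {b} a<k b<k a≡b = trans (sym (m<n⇒m%n≡m a<k)) (trans a≡b (m<n⇒m%n≡m b<k))

module Shifts (n k : ℕ) .{{_ : NonZero k}} (n<k : n < k) where
  open Modular k

  shift : ℕ → Fin n → Fin k
  shift e i = (toℕ i + e) mod k

  toℕ-shift : ∀ e i → toℕ (shift e i) ≡ (toℕ i + e) % k
  toℕ-shift e i = FinP.toℕ-fromℕ< _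

  toℕ<k : (i : Fin n) → toℕ i < k
  toℕ<k i = <-trans (FinP.toℕ<n i) n<k

  shift-≡ : ∀ e e′ i i′ → shift e i ≡ shift e′ i′ → (toℕ i + e) % k ≡ (toℕ i′ + e′) % k
  shift-≡ e e′ i i′ eq = trans (sym (toℕ-shift e i)) (trans (cong toℕ eq) (toℕ-shift e′ i′))

  shift-injective : ∀ e → Injective _≡_ _≡_ (shift e)
  shift-injective e {i} {i′} eq =
    FinP.toℕ-injective (%-injective (toℕ<k i) (toℕ<k i′) (%-cancel-+ʳ e (shift-≡ e e i i′ eq)))

  shift-offset : ∀ {e e′} i → shift e i ≡ shift e′ i → e % k ≡ e′ % k
  shift-offset {e} {e′} i eq = %-cancel-+ʳ (toℕ i) (begin
    (e + toℕ i) % k  ≡⟨ cong (_% k) (+-comm e (toℕ i)) ⟩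
    (toℕ i + e) % k  ≡⟨ shift-≡ e e′ i i eq ⟩
    (toℕ i + e′) % k ≡⟨ cong (_% k) (+-comm (toℕ i) e′) ⟩
    (e′ + toℕ i) % k ∎)
    where open ≡-Reasoning

  shift-cong : ∀ {e e′} i → e % k ≡ e′ % k → shift e i ≡ shift e′ i
  shift-cong {e} {e′} i e≡e′ = FinP.toℕ-injective (begin
    toℕ (shift e i)   ≡⟨ toℕ-shift e i ⟩
    (toℕ i + e) % k   ≡⟨ %-cong-+ˡ (toℕ i) e≡e′ ⟩
    (toℕ i + e′) % k  ≡⟨ toℕ-shift e′ i ⟨
    toℕ (shift e′ i)  ∎)
    where open ≡-Reasoning

  shift-suc : ∀ {j i i′} → shift j i ≡ shift (suc j) i′ → toℕ i ≡ suc (toℕ i′)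
  shift-suc {j} {i} {i′} eq = %-injective (toℕ<k i) (≤-<-trans (FinP.toℕ<n i′) n<k)
    (%-cancel-+ʳ j (trans (shift-≡ j (suc j) i i′ eq) (cong (_% k) (+-suc (toℕ i′) j))))

  shift-onto : ∀ i c → ∃ λ e → e < k × shift e i ≡ c
  shift-onto i c = e , m%n<n _ k , FinP.toℕ-injective (begin
      toℕ (shift e i)                     ≡⟨ toℕ-shift e i ⟩
      (toℕ i + e) % k                     ≡⟨ %-cong-+ˡ (toℕ i) (m%n%n≡m%n (toℕ c + (k ∸ toℕ i)) k) ⟩
      (toℕ i + (toℕ c + (k ∸ toℕ i))) % k ≡⟨ cong (_% k) (+-∸-cancel (toℕ c) (<⇒≤ (toℕ<k i))) ⟩
      (toℕ c + k) % k                     ≡⟨ [m+n]%n≡m%n (toℕ c) k ⟩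
      toℕ c % k                           ≡⟨ m<n⇒m%n≡m (FinP.toℕ<n c) ⟩
      toℕ c                               ∎)
    where
    open ≡-Reasoning
    e = (toℕ c + (k ∸ toℕ i)) % k
    +-∸-cancel : ∀ a {b} → b ≤ k → b + (a + (k ∸ b)) ≡ a + k
    +-∸-cancel a {b} b≤k = begin
      b + (a + (k ∸ b)) ≡⟨ +-assoc b a (k ∸ b) ⟨
      b + a + (k ∸ b)   ≡⟨ cong (_+ (k ∸ b)) (+-comm b a) ⟩
      a + b + (k ∸ b)   ≡⟨ +-assoc a b (k ∸ b) ⟩
      a + (b + (k ∸ b)) ≡⟨ cong (a +_) (m+[n∸m]≡n b≤k) ⟩
      a + k             ∎

  shift-window : ∀ {z} → z < k → ∀ i c → ∃ λ s → 0 < s × s ≤ k × shift (z + s) i ≡ c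
  shift-window {z} z<k i c with shift-onto i c
  ... | e , e<k , eq with z <? e
  ...   | yes z<e = e ∸ z , m<n⇒0<n∸m z<e , ≤-trans (m∸n≤m e z) (<⇒≤ e<k)
                    , trans (cong (λ x → shift x i) (m+[n∸m]≡n (<⇒≤ z<e))) eq
  ...   | no z≮e  = e + k ∸ z , m<n⇒0<n∸m (<-≤-trans z<k (m≤n+m k e))
                    , ≤-trans (∸-monoˡ-≤ z (+-monoˡ-≤ k e≤z)) (≤-reflexive (m+n∸m≡n z k))
                    , trans (cong (λ x → shift x i) (m+[n∸m]≡n (≤-trans (<⇒≤ z<k) (m≤n+m k e))))
                            (trans (shift-cong i ([m+n]%n≡m%n e k)) eq)
    where e≤z = ≮⇒≥ z≮e

  -- Two offsets below k cannot hit the same position, and there are more offsets than positions.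
  ¬every-offset-hits : ∀ (c : Fin n → Fin k) → ¬ (∀ (e : Fin k) → ∃ λ i → shift (toℕ e) i ≡ c i)
  ¬every-offset-hits c every with FinP.pigeonhole n<k (proj₁ ∘ every)
  ... | e₁ , e₂ , e₁<e₂ , same =
    <-irrefl (%-injective (FinP.toℕ<n e₁) (FinP.toℕ<n e₂) (shift-offset {toℕ e₁} {toℕ e₂} i both)) e₁<e₂
    where
    i = proj₁ (every e₁)
    both : shift (toℕ e₁) i ≡ shift (toℕ e₂) i
    both = trans (proj₂ (every e₁)) (sym (subst (λ x → shift (toℕ e₂) x ≡ c x) (sym same) (proj₂ (every e₂))))

  split : ℕ → ℕ → Fin n → Fin k
  split j m i = if toℕ i <ᵇ m then shift j i else shift (suc j) i

  split-injective : ∀ j m → Injective _≡_ _≡_ (split j m)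
  split-injective j m {i} {i′} eq
    with toℕ i <ᵇ m | <ᵇ-reflects-< (toℕ i) m | toℕ i′ <ᵇ m | <ᵇ-reflects-< (toℕ i′) m
  ... | true  | _         | true  | _          = shift-injective j eq
  ... | false | _         | false | _          = shift-injective (suc j) eq
  ... | true  | ofʸ i<m   | false | ofⁿ i′≮m   = ⊥-elim (i′≮m (<-trans (≤-reflexive (sym (shift-suc eq))) i<m))
  ... | false | ofⁿ i≮m   | true  | ofʸ i′<m   = ⊥-elim (i≮m (<-trans (≤-reflexive (sym (shift-suc (sym eq)))) i′<m))

  shiftCode : ℕ → Code n k
  shiftCode e = shift e , shift-injective e

  splitCode : ℕ → ℕ → Code n k
  splitCode j m = split j m , split-injective j m

logSum : ℕ → ℕ
logSum zero    = 0
logSum (suc m) = logSum m + ⌈log₂ suc m ⌉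

-- pos₀ only serves as the default value of pick.
module Codebreaker (n k′ : ℕ) (n<k : n < suc k′) (pos₀ : Fin n) where

  k : ℕ
  k = suc k′

  open Shifts n k n<k
  open Adaptive (shiftCode 0) public
  open Candidates

  -- A state: the positions still unknown, and a guess that is correct off them.
  State : Set
  State = (Fin n → Bool) × (Fin n → Fin k)

  knownHits : (Fin n → Fin k) → State → ℕ
  knownHits q (u , g) = count (λ i → not (u i) ∧ does (q i Fin.≟ g i))

  -- Does offset j hit some unknown position below m?  Positions from m on are given offset j + 1,
  -- which hits no unknown position by the time j is processed, and known positions are discounted.
  probe : ℕ → State → ℕ → Tree Bool
  probe j s m = ask (splitCode j m) λ b → ret (0 <ᵇ b ∸ knownHits (split j m) s)

  locate : ℕ → State → Tree (Fin n)
  locate j s = pick pos₀ cs <$> bisect (probe j s ∘ bound cs) n 0 (count (proj₁ s))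
    where cs = candidates (proj₁ s)

  settle : Fin n → Fin k → State → State
  settle o c (u , g) = updateAt u o (const false) , updateAt g o (const c)

  fill : ℕ → ℕ → State → Tree State
  fill j zero    s = ret s
  fill j (suc r) s = locate j s >>= λ o → fill j r (settle o (shift j o) s)

  sweep : (ℕ → ℕ) → ℕ → ℕ → State → Tree State
  sweep a z zero    s = ret s
  sweep a z (suc t) s = fill j (a (j % k) ∸ knownHits (shift j) s) s >>= sweep a z t
    where j = z + suc t

  record-score : ℕ → (ℕ → ℕ) → Tree (ℕ → ℕ)
  record-score c a = ask (shiftCode c) λ b → ret (λ e → if e ℕ.≡ᵇ c then b else a e)

  survey : ℕ → Tree (ℕ → ℕ)
  survey zero    = ret (λ _ → 0)
  survey (suc c) = survey c >>= record-score c

  -- The fallback 0 is never taken against a real secret, by ¬every-offset-hits.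
  quietOffset : (ℕ → ℕ) → ℕ
  quietOffset a with FinP.any? (λ (e : Fin k) → a (toℕ e) ℕ.≟ 0)
  ... | yes (e , _) = toℕ e
  ... | no _        = 0

  start : State
  start = const true , shift 0

  solve : (ℕ → ℕ) → Tree (Fin n → Fin k)
  solve a = proj₂ <$> sweep a (quietOffset a) k′ start

  breaker : Tree (Fin n → Fin k)
  breaker = survey k >>= solve

  module Correct (y : Code n k) where

    secret : Fin n → Fin k
    secret = proj₁ y

    hit : ℕ → Fin n → Bool
    hit j i = does (shift j i Fin.≟ secret i)

    T-hit : ∀ {j i} → T (hit j i) → shift j i ≡ secret i
    T-hit {j} {i} h with shift j i Fin.≟ secret i
    ... | yes eq = eq

    hit-T : ∀ {j i} → shift j i ≡ secret i → T (hit j i)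
    hit-T {j} {i} eq with shift j i Fin.≟ secret i
    ... | yes _  = _
    ... | no neq = neq eq

    answer≡count : ∀ q → answer q y ≡ count (λ i → does (proj₁ q i Fin.≟ secret i))
    answer≡count q = length-filter-tabulate (λ i → proj₁ q i Fin.≟ secret i) id

    Sound : State → Set
    Sound (u , g) = ∀ i → ¬ T (u i) → g i ≡ secret i

    Found : ℕ → (Fin n → Bool) → Fin n → Set
    Found j u o = T (u o) × shift j o ≡ secret o

    Misses : ℕ → (Fin n → Bool) → Set
    Misses j u = ∀ i → T (u i) → shift j i ≢ secret i

    unknownHits : ∀ s → Sound s → ∀ q →
                  answer q y ∸ knownHits (proj₁ q) s ≡ count (λ i → proj₁ s i ∧ does (proj₁ q i Fin.≟ secret i))
    unknownHits (u , g) sound (q , q-inj) = begin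
      answer (q , q-inj) y ∸ K          ≡⟨ cong (_∸ K) (trans (answer≡count (q , q-inj)) (count-split u _)) ⟩
      count onU + count offU ∸ K        ≡⟨ cong (λ c → count onU + c ∸ K) (count-cong known) ⟩
      count onU + K ∸ K                 ≡⟨ m+n∸n≡m (count onU) K ⟩
      count onU                         ∎
      where
      open ≡-Reasoning
      K = knownHits q (u , g)
      onU offU : Fin n → Bool
      onU  i = u i ∧ does (q i Fin.≟ secret i)
      offU i = not (u i) ∧ does (q i Fin.≟ secret i)
      known : ∀ i → offU i ≡ not (u i) ∧ does (q i Fin.≟ g i)
      known i with u i in ui
      ... | true  = refl
      ... | false rewrite sound i (subst (¬_ ∘ T) (sym ui) λ ()) = refl

    module _ (j : ℕ) (s : State) (sound : Sound s) (misses : Misses (suc j) (proj₁ s)) where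

      private
        u = proj₁ s

      hitBelow : ℕ → Fin n → Bool
      hitBelow m i = u i ∧ ((toℕ i <ᵇ m) ∧ hit j i)

      run-probe : ∀ m → run y (probe j s m) ≡ (0 <ᵇ count (hitBelow m))
      run-probe m = cong (0 <ᵇ_) (trans (unknownHits s sound (splitCode j m)) (count-cong split-hit))
        where
        split-hit : ∀ i → u i ∧ does (split j m i Fin.≟ secret i) ≡ hitBelow m i
        split-hit i with u i in ui
        ... | false = refl
        ... | true with toℕ i <ᵇ m
        ...   | true  = refl
        ...   | false with shift (suc j) i Fin.≟ secret i
        ...     | yes eq = ⊥-elim (misses i (subst T (sym ui) _) eq)
        ...     | no _   = refl

      probe-true : ∀ m → T (run y (probe j s m)) → ∃ λ i → T (u i) × toℕ i < m × shift j i ≡ secret i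
      probe-true m yes′ with count-positive (hitBelow m) (<ᵇ⇒< 0 _ (subst T (run-probe m) yes′))
      ... | i , below with Equivalence.to T-∧ below
      ...   | ui , rest with Equivalence.to T-∧ rest
      ...     | i<m , h = i , ui , <ᵇ⇒< (toℕ i) m i<m , T-hit h

      probe-false : ∀ m → ¬ T (run y (probe j s m)) → ∀ i → T (u i) → shift j i ≡ secret i → m ≤ toℕ i
      probe-false m no′ i ui eq = ≮⇒≥ λ i<m → no′ (subst T (sym (run-probe m))
        (<⇒<ᵇ (1≤count (hitBelow m) i (Equivalence.from T-∧ (ui , Equivalence.from T-∧ (<⇒<ᵇ i<m , hit-T eq))))))

      private
        cs = candidates u

      probe-first : ¬ T (run y (probe j s (bound cs 0)))
      probe-first yes′ with probe-true (bound cs 0) yes′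
      ... | i , ui , i<b , _ = <⇒≱ i<b (bound-zero≤ (candidates-ascending u) (∈-candidates u ui))

      probe-last : ∀ x → T (u x) → shift j x ≡ secret x → T (run y (probe j s (bound cs (count u))))
      probe-last x ux hx = subst T (sym (run-probe (bound cs (count u))))
        (<⇒<ᵇ (1≤count (hitBelow (bound cs (count u))) x
          (Equivalence.from T-∧ (ux , Equivalence.from T-∧ (<⇒<ᵇ x<bound , hit-T hx)))))
        where
        x<bound : toℕ x < bound cs (count u)
        x<bound = subst (λ ℓ → toℕ x < bound cs ℓ) (length-candidates u)
                    (subst (toℕ x <_) (sym (bound-length cs)) (FinP.toℕ<n x))

      locate-finds : 1 ≤ count (λ i → u i ∧ hit j i) → Found j u (run y (locate j s))
      locate-finds pos = subst (Found j u) (sym (run-<$> y (pick pos₀ cs) (bisect test n 0 (count u)))) found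
        where
        x = proj₁ (count-positive (λ i → u i ∧ hit j i) pos)
        ux,hx = Equivalence.to T-∧ (proj₂ (count-positive (λ i → u i ∧ hit j i) pos))
        ux = proj₁ ux,hx
        hx = T-hit (proj₂ ux,hx)
        test = probe j s ∘ bound cs
        ℓ = run y (bisect test n 0 (count u))
        flips : Flips test y ℓ (suc ℓ)
        flips = bisect-flips test y n 0 (count u) (1≤count u x ux) (count≤ u) (probe-first , probe-last x ux hx)
        found : Found j u (pick pos₀ cs ℓ)
        found with probe-true _ (proj₂ flips)
        ... | i , ui , i<b , eq = subst (Found j u)
          (between-bounds⇒pick pos₀ ℓ (candidates-ascending u) (∈-candidates u ui) (probe-false _ (proj₁ flips) i ui eq) i<b)
          (ui , eq)

    locate-cost : ∀ j s → cost y (locate j s) ≤ ⌈log₂ count (proj₁ s) ⌉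
    locate-cost j s = ≤-trans (≤-reflexive (cost-<$> y (pick pos₀ cs) (bisect test n 0 (count (proj₁ s)))))
                              (bisect-cost test y (λ _ → refl) n 0 (count (proj₁ s)))
      where
      cs = candidates (proj₁ s)
      test = probe j s ∘ bound cs

    settle-sound : ∀ {j o} s → Sound s → shift j o ≡ secret o → Sound (settle o (shift j o) s)
    settle-sound {o = o} (u , g) sound hit-o i unknown′ with i Fin.≟ o
    ... | yes refl = trans (updateAt-updates o g) hit-o
    ... | no i≢o   = trans (updateAt-minimal i o g i≢o)
                           (sound i (subst (¬_ ∘ T) (updateAt-minimal i o u i≢o) unknown′))

    settle-⊆ : ∀ o c s i → T (proj₁ (settle o c s) i) → T (proj₁ s i)
    settle-⊆ o c (u , g) i u′i with i Fin.≟ o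
    ... | yes refl = ⊥-elim (subst T (updateAt-updates o u) u′i)
    ... | no i≢o   = subst T (updateAt-minimal i o u i≢o) u′i

    count-settle : ∀ o c s (f : Fin n → Bool) → T (proj₁ s o ∧ f o) →
                   count (λ i → proj₁ s i ∧ f i) ≡ suc (count (λ i → proj₁ (settle o c s) i ∧ f i))
    count-settle o c (u , g) f uo∧fo = count-remove _ _ o uo∧fo
      (λ u′o∧fo → subst T (updateAt-updates o u) (proj₁ (Equivalence.to T-∧ u′o∧fo)))
      (λ i i≢o → cong (_∧ f i) (updateAt-minimal i o u i≢o))

    record Filled (j : ℕ) (u : Fin n → Bool) (c : ℕ) (s′ : State) : Set where
      field
        sound  : Sound s′
        ⊆      : ∀ i → T (proj₁ s′ i) → T (u i)
        misses : Misses j (proj₁ s′)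
        budget : c + logSum (count (proj₁ s′)) ≤ logSum (count u)

    fill-correct : ∀ j r s → Sound s → Misses (suc j) (proj₁ s) → r ≡ count (λ i → proj₁ s i ∧ hit j i) →
                   Filled j (proj₁ s) (cost y (fill j r s)) (run y (fill j r s))
    fill-correct j zero s sound _ r≡ = record
      { sound  = sound
      ; ⊆      = λ _ ui → ui
      ; misses = λ i ui eq → count-zero _ (sym r≡) i (Equivalence.from T-∧ (ui , hit-T eq))
      ; budget = ≤-refl
      }
    fill-correct j (suc r) s@(u , _) sound misses r≡ =
      subst₂ (Filled j u) (sym (cost->>= y (locate j s) next)) (sym (run->>= y (locate j s) next)) (record
        { sound  = Filled.sound rest
        ; ⊆      = λ i → settle-⊆ o (shift j o) s i ∘ Filled.⊆ rest i
        ; misses = Filled.misses rest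
        ; budget = budget
        })
      where
      next = λ o → fill j r (settle o (shift j o) s)
      o = run y (locate j s)
      s₁ = settle o (shift j o) s
      found = locate-finds j s sound misses (subst (1 ≤_) r≡ (s≤s z≤n))
      uo∧hit : T (u o ∧ hit j o)
      uo∧hit = Equivalence.from T-∧ (proj₁ found , hit-T (proj₂ found))
      shrinks : count u ≡ suc (count (proj₁ s₁))
      shrinks = trans (count-cong (λ i → sym (∧-identityʳ (u i))))
                (trans (count-settle o (shift j o) s (const true) (Equivalence.from T-∧ (proj₁ found , _)))
                       (cong suc (count-cong (λ i → ∧-identityʳ (proj₁ s₁ i)))))
      rest = fill-correct j r s₁ (settle-sound s sound (proj₂ found)) (λ i → misses i ∘ settle-⊆ o (shift j o) s i)
               (suc-injective (trans r≡ (count-settle o (shift j o) s (hit j) uo∧hit)))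
      budget : cost y (locate j s) + cost y (next o) + logSum (count (proj₁ (run y (next o)))) ≤ logSum (count u)
      budget = begin
        cost y (locate j s) + cost y (next o) + logSum (count (proj₁ (run y (next o))))
          ≡⟨ +-assoc (cost y (locate j s)) _ _ ⟩
        cost y (locate j s) + (cost y (next o) + logSum (count (proj₁ (run y (next o)))))
          ≤⟨ +-mono-≤ (≤-trans (locate-cost j s) (≤-reflexive (cong ⌈log₂_⌉ shrinks))) (Filled.budget rest) ⟩
        ⌈log₂ suc (count (proj₁ s₁)) ⌉ + logSum (count (proj₁ s₁))
          ≡⟨ +-comm _ (logSum (count (proj₁ s₁))) ⟩
        logSum (suc (count (proj₁ s₁)))
          ≡⟨ cong logSum shrinks ⟨
        logSum (count u) ∎
        where open ≤-Reasoning

    Survey : (ℕ → ℕ) → Set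
    Survey a = ∀ e → e < k → a e ≡ count (hit e)

    remaining-hits : ∀ a j s → Survey a → Sound s →
                     a (j % k) ∸ knownHits (shift j) s ≡ count (λ i → proj₁ s i ∧ hit j i)
    remaining-hits a j s survey sound =
      trans (cong (_∸ knownHits (shift j) s) (begin
        a (j % k)           ≡⟨ survey (j % k) (m%n<n j k) ⟩
        count (hit (j % k)) ≡⟨ count-cong (λ i → cong (λ c → does (c Fin.≟ secret i))
                                                         (shift-cong i (m%n%n≡m%n j k))) ⟩
        count (hit j)       ≡⟨ answer≡count (shiftCode j) ⟨
        answer (shiftCode j) y ∎))
        (unknownHits s sound (shiftCode j))
      where open ≡-Reasoning

    -- The offsets z + t + 1, …, z + k have been processed.
    Quiet : ℕ → ℕ → (Fin n → Bool) → Set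
    Quiet z t u = ∀ s → t < s → s ≤ k → Misses (z + s) u

    sweep-correct : ∀ a z t s → Survey a → z < k → t ≤ k′ → Sound s → Quiet z t (proj₁ s) →
                    (∀ i → proj₂ (run y (sweep a z t s)) i ≡ secret i) ×
                    cost y (sweep a z t s) ≤ logSum (count (proj₁ s))
    sweep-correct a z zero (u , g) _ z<k _ sound quiet = solved , z≤n
      where
      solved : ∀ i → g i ≡ secret i
      solved i with u i in ui
      ... | false = sound i (subst (¬_ ∘ T) (sym ui) λ ())
      ... | true with shift-window z<k i (secret i)
      ...   | s , 0<s , s≤k , eq = ⊥-elim (quiet s 0<s s≤k i (subst T (sym ui) _) eq)
    sweep-correct a z (suc t) s@(u , _) survey z<k t<k′ sound quiet =
        subst (λ s′ → ∀ i → proj₂ s′ i ≡ secret i) (sym (run->>= y (fill j r s) (sweep a z t))) (proj₁ rest)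
      , subst (_≤ logSum (count u)) (sym (cost->>= y (fill j r s) (sweep a z t)))
          (≤-trans (+-monoʳ-≤ (cost y (fill j r s)) (proj₂ rest)) (Filled.budget filled))
      where
      j = z + suc t
      r = a (j % k) ∸ knownHits (shift j) s
      next-quiet : Misses (suc j) u
      next-quiet i ui = subst (λ e → shift e i ≢ secret i) (+-suc z (suc t)) (quiet (suc (suc t)) ≤-refl (s≤s t<k′) i ui)
      filled = fill-correct j r s sound next-quiet (remaining-hits a j s survey sound)
      s′ = run y (fill j r s)
      quiet′ : Quiet z t (proj₁ s′)
      quiet′ s₁ t<s₁ s₁≤k with s₁ ℕ.≟ suc t
      ... | yes refl = Filled.misses filled
      ... | no s₁≢   = λ i → quiet s₁ (≤∧≢⇒< t<s₁ (s₁≢ ∘ sym)) s₁≤k i ∘ Filled.⊆ filled i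
      rest = sweep-correct a z t s′ survey z<k (≤-trans (n≤1+n t) t<k′) (Filled.sound filled) quiet′

    survey-cost : ∀ c → cost y (survey c) ≡ c
    survey-cost zero    = refl
    survey-cost (suc c) = trans (cost->>= y (survey c) (record-score c)) (trans (cong (_+ 1) (survey-cost c)) (+-comm c 1))

    survey-answers : ∀ c e → e < c → run y (survey c) e ≡ count (hit e)
    survey-answers (suc c) e e<c = trans (cong (λ a → a e) (run->>= y (survey c) (record-score c))) last-or-earlier
      where
      last-or-earlier : (if e ℕ.≡ᵇ c then answer (shiftCode c) y else run y (survey c) e) ≡ count (hit e)
      last-or-earlier with e ℕ.≡ᵇ c in e≡ᵇc
      ... | true  rewrite ≡ᵇ⇒≡ e c (subst T (sym e≡ᵇc) _) = answer≡count (shiftCode c)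
      ... | false = survey-answers c e (≤∧≢⇒< (≤-pred e<c) λ e≡c → subst T e≡ᵇc (≡⇒≡ᵇ e c e≡c))

    quietOffset<k : ∀ a → quietOffset a < k
    quietOffset<k a with FinP.any? (λ (e : Fin k) → a (toℕ e) ℕ.≟ 0)
    ... | yes (e , _) = FinP.toℕ<n e
    ... | no _        = s≤s z≤n

    quietOffset-misses : ∀ a → Survey a → Misses (quietOffset a) (const true)
    quietOffset-misses a survey with FinP.any? (λ (e : Fin k) → a (toℕ e) ℕ.≟ 0)
    ... | yes (e , quiet) = λ i _ eq →
      count-zero (hit (toℕ e)) (trans (sym (survey (toℕ e) (FinP.toℕ<n e))) quiet) i (hit-T eq)
    ... | no noisy        = ⊥-elim (¬every-offset-hits secret every)
      where
      every : ∀ e → ∃ λ i → shift (toℕ e) i ≡ secret i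
      every e with count-positive (hit (toℕ e))
                     (n≢0⇒n>0 (λ none → noisy (e , trans (survey (toℕ e) (FinP.toℕ<n e)) none)))
      ... | i , h = i , T-hit h

    start-quiet : ∀ a → Survey a → Quiet (quietOffset a) k′ (const true)
    start-quiet a survey s k′<s s≤k with ≤-antisym s≤k k′<s
    ... | refl = λ i _ eq → quietOffset-misses a survey i _ (trans (shift-cong i (sym ([m+n]%n≡m%n (quietOffset a) k))) eq)

    solve-correct : ∀ a → Survey a → (∀ i → run y (solve a) i ≡ secret i) × cost y (solve a) ≤ logSum n
    solve-correct a survey =
        subst (λ g → ∀ i → g i ≡ secret i) (sym (run-<$> y proj₂ swept)) (proj₁ correct)
      , subst₂ _≤_ (sym (cost-<$> y proj₂ swept)) (cong logSum (count-all {n} (const true) (const _))) (proj₂ correct)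
      where
      swept = sweep a (quietOffset a) k′ start
      correct = sweep-correct a (quietOffset a) k′ start survey (quietOffset<k a) ≤-refl
                  (λ i unknown → ⊥-elim (unknown _)) (start-quiet a survey)

    breaker-correct : (∀ i → run y breaker i ≡ secret i) × cost y breaker ≤ k + logSum n
    breaker-correct =
        subst (λ g → ∀ i → g i ≡ secret i) (sym (run->>= y (survey k) solve)) (proj₁ solved)
      , subst (_≤ k + logSum n) (sym (cost->>= y (survey k) solve))
          (+-mono-≤ (≤-reflexive (survey-cost k)) (proj₂ solved))
      where solved = solve-correct (run y (survey k)) (survey-answers k)

logSum-bound : ∀ m → logSum m ≤ (m ∸ 2) * ⌈log₂ m ⌉ + 1
logSum-bound zero                = z≤n
logSum-bound (suc zero)          = z≤n
logSum-bound (suc (suc zero))    = ≤-refl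
logSum-bound (suc (suc (suc m))) = begin
  logSum (suc (suc m)) + L₃  ≤⟨ +-monoˡ-≤ L₃ (logSum-bound (suc (suc m))) ⟩
  m * L₂ + 1 + L₃            ≤⟨ +-monoˡ-≤ L₃ (+-monoˡ-≤ 1 (*-monoʳ-≤ m (⌈log₂⌉-mono-≤ (n≤1+n (suc (suc m)))))) ⟩
  m * L₃ + 1 + L₃            ≡⟨ +-assoc (m * L₃) 1 L₃ ⟩
  m * L₃ + (1 + L₃)          ≡⟨ cong (m * L₃ +_) (+-comm 1 L₃) ⟩
  m * L₃ + (L₃ + 1)          ≡⟨ +-assoc (m * L₃) L₃ 1 ⟨
  m * L₃ + L₃ + 1            ≡⟨ cong (_+ 1) (+-comm (m * L₃) L₃) ⟩
  suc m * L₃ + 1             ∎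
  where
  open ≤-Reasoning
  L₂ = ⌈log₂ suc (suc m) ⌉
  L₃ = ⌈log₂ suc (suc (suc m)) ⌉

mainTheorem2 : (n k : ℕ) → 1 ≤ n → n < k →
  Σ (Strategy n k) λ s → (y : Code n k) →
    Σ ℕ λ N → (N ≤ (n ∸ 2) * ⌈log₂ n ⌉ + k + 1) × DeterminesAfter s y N
mainTheorem2 (suc n′) (suc k′) _ n<k =
  strategy breaker , λ y → cost y breaker , within-budget y , strategy-determines breaker (proj₁ ∘ breaker-correct) y
  where
  open Codebreaker (suc n′) k′ n<k zero
  open Correct
  within-budget : ∀ y → cost y breaker ≤ (suc n′ ∸ 2) * ⌈log₂ suc n′ ⌉ + suc k′ + 1
  within-budget y = begin
    cost y breaker                                  ≤⟨ proj₂ (breaker-correct y) ⟩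
    suc k′ + logSum (suc n′)                        ≤⟨ +-monoʳ-≤ (suc k′) (logSum-bound (suc n′)) ⟩
    suc k′ + (L + 1)                                ≡⟨ +-assoc (suc k′) L 1 ⟨
    suc k′ + L + 1                                  ≡⟨ cong (_+ 1) (+-comm (suc k′) L) ⟩
    L + suc k′ + 1                                  ∎
    where
    open ≤-Reasoning
    L = (suc n′ ∸ 2) * ⌈log₂ suc n′ ⌉
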